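{- Let $b=\langle b(i):i<\omega\rangle$ be a sequence of non-empty sets and $h,h^+\in\omega^\omega$. Assume there is a partition $I=\langle I_k:k<\omega\rangle$ of $\omega$ into finite non-empty consecutive intervals such that $h(i)\geq h^+(k)$ for all $k<\omega$ and $i\in I_k$, and let $b^+(k):=\prod_{i\in I_k}b(i)$. Then $\mathbf{Lc}(b,h)\preceq_{\mathrm{T}}\mathbf{Lc}(b^+,h^+)$.
   Context: A relational system is a triple $\mathbf{R}=\langle X,Y,\sqsubset\rangle$ with $X,Y$ non-empty sets and $\sqsubset$ a relation. For relational systems $\mathbf{R}=\langle X,Y,\sqsubset\rangle$ and $\mathbf{R}'=\langle X',Y',\sqsubset'\rangle$, $\mathbf{R}\preceq_{\mathrm{T}}\mathbf{R}'$ means there are functions $\Psi_-:X\to X'$ and $\Psi_+:Y'\to Y$ such that for all $x\in X$, $y'\in Y'$: $\Psi_-(x)\sqsubset' y'$ implies $x\sqsubset\Psi_+(y')$. For a sequence $b$ of non-empty sets and $h\in\omega^\omega$: $\prod b=\prod_n b(n)$, $\mathcal{S}(b,h)=\prod_n[b(n)]^{\leq h(n)}$, and $\mathbf{Lc}(b,h)=\langle\prod b,\mathcal{S}(b,h),\in^*\rangle$ where $x\in^*\varphi$ iff $x(n)\in\varphi(n)$ for all but finitely many $n$. -}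

module Defs where

open import Data.Nat using (ℕ; zero; suc; _≤_; _<_)
open import Data.List using (List; length)
open import Data.List.Relation.Unary.Any using (Any)
open import Data.Product using (Σ; _×_; ∃)
open import Relation.Binary.PropositionalEquality using (_≡_)

record RelSys : Set₁ where
  field
    X   : Set
    Y   : Set
    rel : X → Y → Set
open RelSys public

_≼T_ : RelSys → RelSys → Set
R ≼T R' = Σ (X R → X R') λ Ψ₋ → Σ (Y R' → Y R) λ Ψ₊ →
  ∀ (x : X R) (y' : Y R') → rel R' (Ψ₋ x) y' → rel R x (Ψ₊ y')

Prod : (ℕ → Set) → Set
Prod b = (n : ℕ) → b n

-- [A]^{≤ m}: subsets of A of size ≤ m, represented as the set of entries
-- of a list of length ≤ m.
FinSubsetLe : Set → ℕ → Set
FinSubsetLe A m = Σ (List A) λ l → length l ≤ m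

_∈ₛ_ : {A : Set} {m : ℕ} → A → FinSubsetLe A m → Set
x ∈ₛ s = Any (x ≡_) (Data.Product.proj₁ s)

Slalom : (ℕ → Set) → (ℕ → ℕ) → Set
Slalom b h = (n : ℕ) → FinSubsetLe (b n) (h n)

_∈*_ : {b : ℕ → Set} {h : ℕ → ℕ} → Prod b → Slalom b h → Set
x ∈* φ = ∃ λ N → ∀ n → N ≤ n → x n ∈ₛ φ n

Lc : (ℕ → Set) → (ℕ → ℕ) → RelSys
Lc b h = record { X = Prod b ; Y = Slalom b h ; rel = _∈*_ }

-- A partition of ω into finite non-empty consecutive intervals
-- I_k = [ start k , start (k+1) ).
record IntervalPartition : Set where
  field
    start      : ℕ → ℕ
    start-zero : start 0 ≡ 0
    start-incr : ∀ k → start k < start (suc k)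
open IntervalPartition public

_∈I_ : ℕ → (IntervalPartition × ℕ) → Set
i ∈I (I Data.Product., k) = start I k ≤ i × i < start I (suc k)

bPlus : IntervalPartition → (ℕ → Set) → ℕ → Set
bPlus I b k = (i : ℕ) → i ∈I (I Data.Product., k) → b i

-- Group the coordinates of x ∈ ∏ b by the blocks I_k to get an element of ∏ b⁺.
-- Conversely, a slalom φ for b⁺ gives a slalom for b: at i ∈ I_k take the
-- i-th coordinates of the at most h⁺(k) ≤ h(i) elements of φ(k). If the grouped
-- x is caught by φ from block N on, then x is caught from position start N on.
module Submission where

open import Defs
open import Data.Nat using (ℕ; zero; suc; _≤_; _<_; _≤′_; ≤′-refl; ≤′-step)
open import Data.Nat.Properties
  using (≤-refl; ≤-trans; ≤-reflexive; ≤-<-trans; <⇒≤; <⇒≱; ≮⇒≥; m≤n⇒m≤1+n; _<?_; ≤⇒≤′)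
open import Data.Product using (_,_; proj₁; proj₂; ∃)
open import Function using (_∘′_)
open import Data.Sum using (_⊎_; inj₁; inj₂)
open import Data.List using (map)
open import Data.List.Properties using (length-map)
open import Data.List.Membership.Propositional.Properties using (∈-map⁺)
open import Relation.Binary.PropositionalEquality using (sym; subst)
open import Relation.Nullary using (yes; no)

mapₛ : {A B : Set} {m : ℕ} → (A → B) → FinSubsetLe A m → FinSubsetLe B m
mapₛ {m = m} f (l , |l|≤m) = map f l , subst (_≤ m) (sym (length-map f l)) |l|≤m

weakenₛ : {A : Set} {m n : ℕ} → m ≤ n → FinSubsetLe A m → FinSubsetLe A n
weakenₛ m≤n (l , |l|≤m) = l , ≤-trans |l|≤m m≤n

∈ₛ-mapₛ : {A B : Set} {m : ℕ} (f : A → B) {x : A} (s : FinSubsetLe A m)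
  → x ∈ₛ s → f x ∈ₛ mapₛ f s
∈ₛ-mapₛ f _ = ∈-map⁺ f

module _ (I : IntervalPartition) where

  start-mono : ∀ {k m} → k ≤ m → start I k ≤ start I m
  start-mono = go ∘′ ≤⇒≤′
    where
    go : ∀ {k m} → k ≤′ m → start I k ≤ start I m
    go ≤′-refl        = ≤-refl
    go (≤′-step k≤′m) = ≤-trans (go k≤′m) (<⇒≤ (start-incr I _))

  ∈I-suc : ∀ {i k} → i ∈I (I , k) → suc i ∈I (I , k) ⊎ suc i ∈I (I , suc k)
  ∈I-suc {i} {k} (start≤i , i<start′) with suc i <? start I (suc k)
  ... | yes i+1<start′ = inj₁ (m≤n⇒m≤1+n start≤i , i+1<start′)
  ... | no  i+1≮start′ = inj₂ (≮⇒≥ i+1≮start′ , ≤-<-trans i<start′ (start-incr I (suc k)))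

  block : ∀ i → ∃ λ k → i ∈I (I , k)
  block zero = 0 , ≤-reflexive (start-zero I) , subst (_< start I 1) (start-zero I) (start-incr I 0)
  block (suc i) with block i
  ... | k , i∈Ik with ∈I-suc i∈Ik
  ...   | inj₁ i+1∈Ik    = k , i+1∈Ik
  ...   | inj₂ i+1∈Ik+1  = suc k , i+1∈Ik+1

  ∈I-start-≤ : ∀ {i k N} → i ∈I (I , k) → start I N ≤ i → N ≤ k
  ∈I-start-≤ (_ , i<start′) startN≤i =
    ≮⇒≥ λ k<N → <⇒≱ i<start′ (≤-trans (start-mono k<N) startN≤i)

lemma3p14 : (b : ℕ → Set) → ((n : ℕ) → b n) → (h hPlus : ℕ → ℕ)
    → (I : IntervalPartition)
    → (∀ k i → i ∈I (I , k) → hPlus k ≤ h i)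
    → Lc b h ≼T Lc (bPlus I b) hPlus
lemma3p14 b _ h hPlus I hPlus≤h = group , ungroup , caught
  where
  group : Prod b → Prod (bPlus I b)
  group x k i _ = x i

  ungroup : Slalom (bPlus I b) hPlus → Slalom b h
  ungroup φ i with block I i
  ... | k , i∈Ik = weakenₛ (hPlus≤h k i i∈Ik) (mapₛ (λ y → y i i∈Ik) (φ k))

  caught : ∀ x φ → group x ∈* φ → x ∈* ungroup φ
  caught x φ (N , x∈φ) = start I N , λ i startN≤i → caughtAt i startN≤i
    where
    caughtAt : ∀ i → start I N ≤ i → x i ∈ₛ ungroup φ i
    caughtAt i startN≤i with block I i
    ... | k , i∈Ik = ∈ₛ-mapₛ (λ y → y i i∈Ik) (φ k) (x∈φ k (∈I-start-≤ I i∈Ik startN≤i))
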